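{- Let $G$ be a threshold graph with an odd number of vertices. If $h(\mathrm{seq}(G))=0$, then $G$ has a near-perfect matching (a matching covering all but one vertex).
   Context: A threshold graph on $n$ vertices is built from a single base vertex by adding $n-1$ vertices one at a time, each either isolated or dominating (adjacent to all existing vertices); its creation sequence $\mathrm{seq}(G)=s_1\dots s_{n-1}$ has $s_i=1$ if the $i$-th added vertex was dominating and $s_i=0$ if isolated. For a binary sequence $s$ of length $m$ and $0\le k\le m$, let $z_k(s)$ and $u_k(s)$ be the numbers of zeros and ones among the last $k$ digits of $s$, and $h(s)=\max_{0\le k\le m}\{z_k(s)-u_k(s)\}$. -}

module Defs where

open import Data.Bool using (Bool; true; false)
open import Data.Nat using (ℕ; zero; suc; _+_; _*_; _∸_; _<_)
open import Data.Integer using (ℤ; +_; _-_; _⊔_)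
open import Data.Fin using (Fin; zero; suc; toℕ)
open import Data.Vec using (Vec; lookup; toList)
open import Data.List using (List; []; _∷_; length; drop; filter; map; concatMap; upTo; foldr)
open import Data.List.Relation.Unary.All using (All)
open import Data.List.Relation.Unary.Unique.Propositional using (Unique)
open import Data.Product using (Σ; ∃; _×_; _,_; proj₁; proj₂)
open import Data.Sum using (_⊎_)
open import Relation.Binary.PropositionalEquality using (_≡_)

lastDigits : ℕ → List Bool → List Bool
lastDigits k s = drop (length s ∸ k) s

count : Bool → List Bool → ℕ
count b [] = 0
count true  (true  ∷ s) = suc (count true s)
count true  (false ∷ s) = count true s
count false (false ∷ s) = suc (count false s)
count false (true  ∷ s) = count false s

zCount : ℕ → List Bool → ℕ
zCount k s = count false (lastDigits k s)

uCount : ℕ → List Bool → ℕ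
uCount k s = count true (lastDigits k s)

maxℤ : ℤ → List ℤ → ℤ
maxℤ x xs = foldr _⊔_ x xs

-- h(s) = max_{0 ≤ k ≤ m} (z_k(s) - u_k(s)); upTo (suc m) = 0,1,...,m
h : List Bool → ℤ
h s = maxℤ (+ zCount 0 s - + uCount 0 s)
           (map (λ k → + zCount k s - + uCount k s) (upTo (suc (length s))))

-- Threshold graph with creation sequence s (length m) on vertices Fin (suc m).
-- Vertex zero is the base vertex; vertex (suc i) is the (i+1)-th added vertex,
-- which is dominating iff s_{i+1} = 1 (lookup s i ≡ true).

dominating : ∀ {m} → Vec Bool m → Fin (suc m) → Bool
dominating s zero    = false
dominating s (suc i) = lookup s i

ThresholdAdj : ∀ {m} → Vec Bool m → Fin (suc m) → Fin (suc m) → Set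
ThresholdAdj s i j =
  (toℕ i < toℕ j × dominating s j ≡ true) ⊎ (toℕ j < toℕ i × dominating s i ≡ true)

endpoints : ∀ {n} → List (Fin n × Fin n) → List (Fin n)
endpoints = concatMap (λ e → proj₁ e ∷ proj₂ e ∷ [])

NearPerfectMatching : ∀ {n} → (Fin n → Fin n → Set) → Set
NearPerfectMatching {n} Adj =
  Σ (List (Fin n × Fin n)) λ M →
    All (λ e → Adj (proj₁ e) (proj₂ e)) M
    × Unique (endpoints M)
    × suc (2 * length M) ≡ n

Odd : ℕ → Set
Odd n = ∃ λ k → n ≡ suc (2 * k)

-- Read the creation sequence from its last digit backwards, keeping a matching of the
-- vertices seen so far together with a list of still unmatched dominating vertices.
-- A dominating vertex joins that list; an isolated vertex is matched to one of its
-- members, which is later-added and hence adjacent to it.  The list is never empty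
-- when needed because h(s) = 0 says every suffix has at least as many ones as
-- zeros.  At the end the unmatched dominating vertices are pairwise adjacent and,
-- the number of added vertices being even, they pair up; only the base vertex remains.
module Submission where

open import Defs
open import Data.Bool using (Bool; true; false)
open import Data.Nat using (ℕ; zero; suc; _+_; _*_; _∸_; _≤_; _<_; z≤n; s≤s)
import Data.Nat.Properties as ℕP
open import Data.Integer as ℤ using (ℤ; +_)
import Data.Integer.Properties as ℤP
open import Data.Fin using (Fin; zero; suc; toℕ)
import Data.Fin.Properties as FinP
open import Data.Vec using (Vec; []; _∷_; toList; lookup)
open import Data.List using (List; []; _∷_; length; drop; map; upTo; _++_; foldr)
import Data.List.Properties as LP
open import Data.List.Relation.Unary.All as All using (All; []; _∷_)
import Data.List.Relation.Unary.All.Properties as AllP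
open import Data.List.Relation.Unary.AllPairs using ([]; _∷_)
open import Data.List.Relation.Unary.Unique.Propositional using (Unique)
import Data.List.Relation.Unary.Unique.Propositional.Properties as UniqueP
open import Data.List.Relation.Binary.Permutation.Propositional using (_↭_; ↭-sym; ↭⇒↭ₛ)
open import Data.List.Relation.Binary.Permutation.Propositional.Properties using (shift; ↭-length)
import Data.List.Relation.Binary.Permutation.Setoid.Properties as Permₛ
open import Data.List.Membership.Propositional using (_∈_)
open import Data.List.Membership.Propositional.Properties using (∈-upTo⁺; ∈-map⁺)
open import Data.List.Relation.Unary.Any using (here; there)
open import Data.Product as Prod using (Σ; _×_; _,_; proj₁; proj₂)
open import Data.Sum as Sum using (inj₁; inj₂)
open import Data.Empty using (⊥-elim)
open import Relation.Binary.Definitions using (tri<; tri≈; tri>)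
open import Function using (id; _∘′_)
open import Relation.Binary.PropositionalEquality

OnesDominateSuffixes : List Bool → Set
OnesDominateSuffixes l = ∀ j → j ≤ length l → count false (drop j l) ≤ count true (drop j l)

foldr-⊔-upperBound : ∀ {x : ℤ} a xs → x ∈ xs → x ℤ.≤ foldr ℤ._⊔_ a xs
foldr-⊔-upperBound a (y ∷ ys) (here refl) = ℤP.i≤i⊔j y _
foldr-⊔-upperBound a (y ∷ ys) (there x∈ys) =
  ℤP.≤-trans (foldr-⊔-upperBound a ys x∈ys) (ℤP.i≤j⊔i y _)

h≡0⇒onesDominateSuffixes : ∀ l → h l ≡ + 0 → OnesDominateSuffixes l
h≡0⇒onesDominateSuffixes l h≡0 j j≤n =
  ℤP.drop‿+≤+ (ℤP.i-j≤0⇒i≤j (subst₂ ℤ._≤_ suffix-j h≡0 term≤h))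
  where
  n = length l
  term : ℕ → ℤ
  term k = + zCount k l ℤ.- + uCount k l
  -- the suffix drop j l consists of the last n ∸ j digits
  term≤h : term (n ∸ j) ℤ.≤ h l
  term≤h = foldr-⊔-upperBound _ _ (∈-map⁺ term (∈-upTo⁺ (s≤s (ℕP.m∸n≤m n j))))
  suffix-j : term (n ∸ j) ≡ + count false (drop j l) ℤ.- + count true (drop j l)
  suffix-j = cong (λ d → + count false (drop d l) ℤ.- + count true (drop d l)) (ℕP.m∸[m∸n]≡n j≤n)

Edges : ∀ {n} → (Fin n → Fin n → Set) → List (Fin n × Fin n) → Set
Edges Adj = All (λ e → Adj (proj₁ e) (proj₂ e))

mapEdges : ∀ {n n′} → (Fin n → Fin n′) → List (Fin n × Fin n) → List (Fin n′ × Fin n′)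
mapEdges f = map (Prod.map f f)

Edges-map : ∀ {n n′} {A : Fin n → Fin n → Set} {B : Fin n′ → Fin n′ → Set} (f : Fin n → Fin n′) →
  (∀ {x y} → A x y → B (f x) (f y)) → ∀ {M} → Edges A M → Edges B (mapEdges f M)
Edges-map f hom es = AllP.map⁺ (All.map hom es)

endpoints-map : ∀ {n n′} (f : Fin n → Fin n′) M → endpoints (mapEdges f M) ≡ map f (endpoints M)
endpoints-map f [] = refl
endpoints-map f ((a , b) ∷ M) = cong (λ t → f a ∷ f b ∷ t) (endpoints-map f M)

endpoints-++ : ∀ {n} (M N : List (Fin n × Fin n)) → endpoints (M ++ N) ≡ endpoints M ++ endpoints N
endpoints-++ [] N = refl
endpoints-++ ((a , b) ∷ M) N = cong (λ t → a ∷ b ∷ t) (endpoints-++ M N)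

length-endpoints : ∀ {n} (M : List (Fin n × Fin n)) → length (endpoints M) ≡ 2 * length M
length-endpoints [] = refl
length-endpoints (e ∷ M) =
  trans (cong (suc ∘′ suc) (length-endpoints M)) (cong suc (sym (ℕP.+-suc (length M) (length M + 0))))

PerfectMatching : ∀ {n} → (Fin n → Fin n → Set) → Set
PerfectMatching {n} Adj =
  Σ (List (Fin n × Fin n)) λ M → Edges Adj M × Unique (endpoints M) × 2 * length M ≡ n

Unique-resp-↭ : ∀ {A : Set} {xs ys : List A} → xs ↭ ys → Unique xs → Unique ys
Unique-resp-↭ {A} p = Permₛ.Unique-resp-↭ (setoid A) (↭⇒↭ₛ p)

Unique-zero∷map-suc : ∀ {n} {xs : List (Fin n)} → Unique xs → Unique (zero ∷ map suc xs)
Unique-zero∷map-suc {xs = xs} u =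
  AllP.map⁺ (All.universal (λ _ ()) xs) ∷ UniqueP.map⁺ FinP.suc-injective u

module _ {n : ℕ} (ys zs : List (Fin n)) where

  private
    insert-zero↭ : map suc ys ++ zero ∷ map suc zs ↭ zero ∷ map suc (ys ++ zs)
    insert-zero↭ = subst (λ (t : List (Fin (suc n))) → map suc ys ++ zero ∷ map suc zs ↭ zero ∷ t)
                         (sym (LP.map-++ suc ys zs)) (shift zero (map suc ys) (map suc zs))

  Unique-insert-zero : Unique (ys ++ zs) → Unique (map suc ys ++ zero ∷ map suc zs)
  Unique-insert-zero u = Unique-resp-↭ {Fin (suc n)} (↭-sym insert-zero↭) (Unique-zero∷map-suc u)

  length-insert-zero : length (map suc ys ++ zero ∷ map suc zs) ≡ suc (length (ys ++ zs))
  length-insert-zero = trans (↭-length insert-zero↭) (cong suc (LP.length-map suc (ys ++ zs)))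

Unique-++⁻ʳ : ∀ {A : Set} (xs : List A) {ys} → Unique (xs ++ ys) → Unique ys
Unique-++⁻ʳ [] u = u
Unique-++⁻ʳ (x ∷ xs) (_ ∷ u) = Unique-++⁻ʳ xs u

pairs : ∀ {A : Set} → List A → List (A × A)
pairs (x ∷ y ∷ xs) = (x , y) ∷ pairs xs
pairs _ = []

endpoints-pairs : ∀ {n} j (xs : List (Fin n)) → length xs ≡ 2 * j → endpoints (pairs xs) ≡ xs
endpoints-pairs zero [] _ = refl
endpoints-pairs (suc j) (x ∷ y ∷ xs) len≡ =
  cong (λ t → x ∷ y ∷ t)
       (endpoints-pairs j xs (ℕP.suc-injective (trans (ℕP.suc-injective len≡) (ℕP.+-suc j (j + 0)))))
endpoints-pairs (suc j) (x ∷ []) len≡ with trans (ℕP.suc-injective len≡) (ℕP.+-suc j (j + 0))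
... | ()

-- The threshold graph without its base vertex: digit i of s is vertex i here.
AddedAdj : ∀ {k} → Vec Bool k → Fin k → Fin k → Set
AddedAdj s x y = ThresholdAdj s (suc x) (suc y)

Edges-AddedAdj-∷ : ∀ {k b} {s : Vec Bool k} {M} →
  Edges (AddedAdj s) M → Edges (AddedAdj (b ∷ s)) (mapEdges suc M)
Edges-AddedAdj-∷ {b = b} {s} =
  Edges-map {A = AddedAdj s} {B = AddedAdj (b ∷ s)} suc (Sum.map (Prod.map s≤s id) (Prod.map s≤s id))

AddedAdj-dominating : ∀ {k} {s : Vec Bool k} {x y} →
  x ≢ y → lookup s x ≡ true → lookup s y ≡ true → AddedAdj s x y
AddedAdj-dominating {x = x} {y} x≢y dx dy with ℕP.<-cmp (toℕ x) (toℕ y)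
... | tri< x<y _ _ = inj₁ (s≤s x<y , dy)
... | tri≈ _ x≡y _ = ⊥-elim (x≢y (FinP.toℕ-injective x≡y))
... | tri> _ _ y<x = inj₂ (s≤s y<x , dx)

Edges-pairs : ∀ {k} {s : Vec Bool k} (xs : List (Fin k)) →
  All (λ x → lookup s x ≡ true) xs → Unique xs → Edges (AddedAdj s) (pairs xs)
Edges-pairs [] _ _ = []
Edges-pairs (x ∷ []) _ _ = []
Edges-pairs {s = s} (x ∷ y ∷ xs) (dx ∷ dy ∷ dxs) ((x≢y ∷ _) ∷ _ ∷ u) =
  AddedAdj-dominating {s = s} x≢y dx dy ∷ Edges-pairs {s = s} xs dxs u

record SurplusMatching {k} (s : Vec Bool k) : Set where
  constructor surplusMatching
  field
    matching : List (Fin k × Fin k)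
    surplus : List (Fin k)
    matching-edges : Edges (AddedAdj s) matching
    surplus-dominating : All (λ x → lookup s x ≡ true) surplus
    covered-unique : Unique (endpoints matching ++ surplus)
    covered-length : length (endpoints matching ++ surplus) ≡ k
    surplus-count : count true (toList s) ≡ count false (toList s) + length surplus

module _ {k} {s : Vec Bool k} where

  pushDominating : SurplusMatching s → SurplusMatching (true ∷ s)
  pushDominating (surplusMatching M P edges dominating unique covers count≡) =
    surplusMatching (mapEdges suc M) (zero ∷ map suc P)
      (Edges-AddedAdj-∷ edges)
      (refl ∷ AllP.map⁺ dominating)
      (subst Unique covered≡ (Unique-insert-zero (endpoints M) P unique))
      (trans (cong length (sym covered≡))
             (trans (length-insert-zero (endpoints M) P) (cong suc covers)))
      (trans (cong suc count≡)
             (sym (trans (cong (λ l → _ + suc l) (LP.length-map suc P)) (ℕP.+-suc _ _))))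
    where
    covered≡ : map suc (endpoints M) ++ zero ∷ map suc P
             ≡ endpoints (mapEdges suc M) ++ zero ∷ map suc P
    covered≡ = cong (_++ zero ∷ map suc P) (sym (endpoints-map suc M))

  matchIsolated : SurplusMatching s → count false (toList s) < count true (toList s) →
    SurplusMatching (false ∷ s)
  matchIsolated (surplusMatching M [] _ _ _ _ count≡) zeros<ones =
    ⊥-elim (ℕP.<-irrefl (trans (sym (ℕP.+-identityʳ _)) (sym count≡)) zeros<ones)
  matchIsolated (surplusMatching M (p ∷ P) edges (dp ∷ dominating) unique covers count≡) _ =
    surplusMatching (mapEdges suc M ++ (zero , suc p) ∷ []) (map suc P)
      (AllP.++⁺ (Edges-AddedAdj-∷ edges) (inj₁ (s≤s (s≤s z≤n) , dp) ∷ []))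
      (AllP.map⁺ dominating)
      (subst Unique covered≡ (Unique-insert-zero (endpoints M) (p ∷ P) unique))
      (trans (cong length (sym covered≡))
             (trans (length-insert-zero (endpoints M) (p ∷ P)) (cong suc covers)))
      (trans count≡ (trans (ℕP.+-suc _ _) (cong (λ l → suc (_ + l)) (sym (LP.length-map suc P)))))
    where
    covered≡ : map suc (endpoints M) ++ zero ∷ map suc (p ∷ P)
             ≡ endpoints (mapEdges suc M ++ (zero , suc p) ∷ []) ++ map suc P
    covered≡ = begin
      map suc (endpoints M) ++ zero ∷ suc p ∷ map suc P
        ≡⟨ cong (_++ zero ∷ suc p ∷ map suc P) (sym (endpoints-map suc M)) ⟩
      endpoints (mapEdges suc M) ++ zero ∷ suc p ∷ map suc P
        ≡⟨ sym (LP.++-assoc (endpoints (mapEdges suc M)) (zero ∷ suc p ∷ []) (map suc P)) ⟩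
      (endpoints (mapEdges suc M) ++ zero ∷ suc p ∷ []) ++ map suc P
        ≡⟨ cong (_++ map suc P) (sym (endpoints-++ (mapEdges suc M) ((zero , suc p) ∷ []))) ⟩
      endpoints (mapEdges suc M ++ (zero , suc p) ∷ []) ++ map suc P ∎
      where open ≡-Reasoning

greedySurplusMatching : ∀ {k} (s : Vec Bool k) → OnesDominateSuffixes (toList s) → SurplusMatching s
greedySurplusMatching [] _ = surplusMatching [] [] [] [] [] refl refl
greedySurplusMatching (b ∷ s) ones≥zeros
  with greedySurplusMatching s (λ j j≤ → ones≥zeros (suc j) (s≤s j≤))
greedySurplusMatching (true ∷ s) _ | old = pushDominating old
greedySurplusMatching (false ∷ s) ones≥zeros | old = matchIsolated old (ones≥zeros 0 z≤n)

pairUpSurplus : ∀ {k} {s : Vec Bool k} j → 2 * j ≡ k → SurplusMatching s →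
  PerfectMatching (AddedAdj s)
pairUpSurplus {k} {s} j 2j≡k (surplusMatching M P edges dominating unique covers _) =
  M ++ pairs P ,
  AllP.++⁺ edges (Edges-pairs {s = s} P dominating (Unique-++⁻ʳ (endpoints M) unique)) ,
  subst Unique (sym covered≡) unique ,
  trans (sym (length-endpoints (M ++ pairs P))) (trans (cong length covered≡) covers)
  where
  2|M|+|P|≡2j : 2 * length M + length P ≡ 2 * j
  2|M|+|P|≡2j = begin
    2 * length M + length P           ≡⟨ cong (_+ length P) (sym (length-endpoints M)) ⟩
    length (endpoints M) + length P   ≡⟨ sym (LP.length-++ (endpoints M)) ⟩
    length (endpoints M ++ P)         ≡⟨ trans covers (sym 2j≡k) ⟩
    2 * j                             ∎
    where open ≡-Reasoning
  |P|≡2[j∸|M|] : length P ≡ 2 * (j ∸ length M)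
  |P|≡2[j∸|M|] = trans (sym (ℕP.m+n∸m≡n (2 * length M) (length P)))
    (trans (cong (_∸ 2 * length M) 2|M|+|P|≡2j) (sym (ℕP.*-distribˡ-∸ 2 j (length M))))
  covered≡ : endpoints (M ++ pairs P) ≡ endpoints M ++ P
  covered≡ = trans (endpoints-++ M (pairs P))
                   (cong (endpoints M ++_) (endpoints-pairs (j ∸ length M) P |P|≡2[j∸|M|]))

perfect⇒nearPerfect : ∀ {m} {s : Vec Bool m} →
  PerfectMatching (AddedAdj s) → NearPerfectMatching (ThresholdAdj s)
perfect⇒nearPerfect {s = s} (M , edges , unique , 2|M|≡m) =
  mapEdges suc M ,
  Edges-map {A = AddedAdj s} {B = ThresholdAdj s} suc id edges ,
  subst Unique (sym (endpoints-map suc M)) (UniqueP.map⁺ FinP.suc-injective unique) ,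
  cong suc (trans (cong (2 *_) (LP.length-map _ M)) 2|M|≡m)

mainTheorem5 : (m : ℕ) (s : Vec Bool m) → Odd (suc m) → h (toList s) ≡ + 0 →
    NearPerfectMatching (ThresholdAdj s)
mainTheorem5 m s (j , 1+m≡1+2j) h≡0 =
  perfect⇒nearPerfect (pairUpSurplus j (sym (ℕP.suc-injective 1+m≡1+2j))
    (greedySurplusMatching s (h≡0⇒onesDominateSuffixes (toList s) h≡0)))
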